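{- Let $k\ge 0$ be an integer and $n=48k+22$. Define $c_2(r)\in\mathbb{Z}_n$ for $0\le r\le n-1$ as follows (all arithmetic modulo $n$): for $0\le i\le 12k+5$, $c_2(2i)=30k+13+i(12k+6)$; for $0\le i\le 12k+4$, $c_2(2i+1)=12k+5+i(12k+6)$ (this defines $c_2(r)$ for $0\le r\le 24k+10$); and for $0\le r\le 24k+10$, $c_2(n-1-r)=n-1-c_2(r)$. Let ${\cal L}_2=[l_2(r,j)]$ be the $n\times n$ array with $l_2(r,j)\equiv c_2(r)+j \pmod n$ for $0\le r,j\le n-1$. Then ${\cal L}_2$ is a Latin square of order $n$.
   Context: A Latin square of order $n$ is an $n\times n$ array in which each row and each column contains each of the symbols $0,1,\dots,n-1$ exactly once. -}

module Defs where

open import Data.Nat using (ℕ; zero; suc; _+_; _*_; _∸_; _≤?_; _/_; _%_)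
open import Data.Nat.DivMod using (m%n<n)
open import Data.Fin using (Fin; toℕ; fromℕ<)
open import Data.Product using (Σ; _×_; _,_)
open import Relation.Binary.PropositionalEquality using (_≡_)
open import Relation.Nullary using (yes; no)

ExactlyOnce : {n : ℕ} → (Fin n → Fin n) → Fin n → Set
ExactlyOnce {n} f s = Σ (Fin n) λ j → (f j ≡ s) × ((j' : Fin n) → f j' ≡ s → j' ≡ j)

IsLatinSquare : (n : ℕ) → (Fin n → Fin n → Fin n) → Set
IsLatinSquare n L =
  ((r : Fin n) (s : Fin n) → ExactlyOnce (λ j → L r j) s) ×
  ((j : Fin n) (s : Fin n) → ExactlyOnce (λ r → L r j) s)

-- n = 48k+22 (written 22 + 48k so it is visibly nonzero)
ord : ℕ → ℕ
ord k = 22 + 48 * k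

c2-low : ℕ → ℕ → ℕ
c2-low k r with r % 2
... | 0 = 30 * k + 13 + (r / 2) * (12 * k + 6)
... | _ = 12 * k + 5 + (r / 2) * (12 * k + 6)

-- c₂(r) ∈ ℤ_n represented by its residue in {0,…,n-1}; for r > 24k+10,
-- c₂(r) = n-1-c₂(n-1-r)  (mod n).
c2 : ℕ → ℕ → ℕ
c2 k r with r ≤? 24 * k + 10
... | yes _ = c2-low k r % ord k
... | no  _ = (ord k ∸ 1) ∸ (c2-low k (ord k ∸ 1 ∸ r) % ord k)

L2 : (k : ℕ) → Fin (ord k) → Fin (ord k) → Fin (ord k)
L2 k r j = fromℕ< (m%n<n (c2 k (toℕ r) + toℕ j) (ord k))

-- The array is cyclic: row r is 0,…,n-1 shifted by c₂(r), so every row is a permutation, and the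
-- columns are permutations exactly when c₂ is injective modulo n. For r ≤ 24k+10 the value c₂(r) is
-- odd, and because 4(12k+6) = n + 2 the map x ↦ 4x + 2 (mod n) sends c₂(2i) to 24k+10+2i and
-- c₂(2i+1) to 2i, which are pairwise distinct. The remaining rows take the even values
-- n-1-c₂(r′) for distinct low rows r′, so they neither collide with each other nor with low rows.

module Submission where

open import Defs
open import Data.Nat using (ℕ; zero; suc; _+_; _*_; _∸_; _≤_; _<_; _≤?_; _/_; _%_; NonZero; parity)
open import Data.Nat.Properties
open import Data.Nat.DivMod
open import Data.Nat.Divisibility using (divides-refl)
open import Data.Nat.Tactic.RingSolver using (solve-∀)
open import Data.Fin using (Fin; toℕ; fromℕ<; punchOut)
open import Data.Fin.Properties using (toℕ-injective; toℕ<n; toℕ-fromℕ<; punchOut-injective; any?; injective⇒≤)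
  renaming (_≟_ to _≟ᶠ_)
open import Data.Parity.Base as ℙ using (0ℙ; 1ℙ)
open import Data.Parity.Properties as ℙₚ using (+-homo-+; *-homo-*)
open import Data.Product using (_×_; _,_)
open import Data.Sum using (_⊎_; inj₁; inj₂)
open import Data.Empty using (⊥-elim)
open import Function using (_∘′_)
open import Function.Definitions using (Injective)
open import Relation.Nullary using (yes; no; contradiction)
open import Relation.Binary.PropositionalEquality

open ≡-Reasoning

injective⇒exactlyOnce : ∀ {n} (f : Fin n → Fin n) → Injective _≡_ _≡_ f → ∀ s → ExactlyOnce f s
injective⇒exactlyOnce {suc m} f f-inj s with any? (λ j → f j ≟ᶠ s)
... | yes (j , fj≡s) = j , fj≡s , λ j′ fj′≡s → f-inj (trans fj′≡s (sym fj≡s))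
... | no ¬hit = contradiction (injective⇒≤ g-inj) (<-irrefl refl)
  where
  missed : ∀ j → s ≢ f j
  missed j s≡fj = ¬hit (j , sym s≡fj)
  g : Fin (suc m) → Fin m
  g j = punchOut (missed j)
  g-inj : Injective _≡_ _≡_ g
  g-inj {a} {b} = f-inj ∘′ punchOut-injective (missed a) (missed b)

module _ {d : ℕ} .{{_ : NonZero d}} where

  %-+-congˡ : ∀ z {x y} → x % d ≡ y % d → (z + x) % d ≡ (z + y) % d
  %-+-congˡ z {x} {y} x≡y = begin
    (z + x) % d           ≡⟨ %-distribˡ-+ z x d ⟩
    (z % d + x % d) % d   ≡⟨ cong (λ t → (z % d + t) % d) x≡y ⟩
    (z % d + y % d) % d   ≡⟨ %-distribˡ-+ z y d ⟨
    (z + y) % d           ∎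

  %-+-congʳ : ∀ z {x y} → x % d ≡ y % d → (x + z) % d ≡ (y + z) % d
  %-+-congʳ z {x} {y} x≡y = begin
    (x + z) % d   ≡⟨ cong (_% d) (+-comm x z) ⟩
    (z + x) % d   ≡⟨ %-+-congˡ z x≡y ⟩
    (z + y) % d   ≡⟨ cong (_% d) (+-comm z y) ⟩
    (y + z) % d   ∎

  %-*-congˡ : ∀ z {x y} → x % d ≡ y % d → (z * x) % d ≡ (z * y) % d
  %-*-congˡ z {x} {y} x≡y = begin
    (z * x) % d           ≡⟨ %-distribˡ-* z x d ⟩
    (z % d * (x % d)) % d ≡⟨ cong (λ t → (z % d * t) % d) x≡y ⟩
    (z % d * (y % d)) % d ≡⟨ %-distribˡ-* z y d ⟨
    (z * y) % d           ∎

  %-+-cancelˡ : ∀ z {x y} → (z + x) % d ≡ (z + y) % d → x % d ≡ y % d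
  %-+-cancelˡ z {x} {y} z+x≡z+y = begin
    x % d                       ≡⟨ unshift x ⟨
    ((d ∸ z % d) + (z + x)) % d ≡⟨ %-+-congˡ (d ∸ z % d) z+x≡z+y ⟩
    ((d ∸ z % d) + (z + y)) % d ≡⟨ unshift y ⟩
    y % d                       ∎
    where
    unshift : ∀ w → ((d ∸ z % d) + (z + w)) % d ≡ w % d
    unshift w = begin
      ((d ∸ z % d) + (z + w)) % d      ≡⟨ %-+-congˡ (d ∸ z % d) (%-+-congʳ w (sym (m%n%n≡m%n z d))) ⟩
      ((d ∸ z % d) + (z % d + w)) % d  ≡⟨ cong (_% d) (+-assoc (d ∸ z % d) (z % d) w) ⟨
      ((d ∸ z % d) + z % d + w) % d    ≡⟨ cong (λ t → (t + w) % d) (m∸n+n≡m (m%n≤n z d)) ⟩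
      (d + w) % d                      ≡⟨ cong (_% d) (+-comm d w) ⟩
      (w + d) % d                      ≡⟨ [m+n]%n≡m%n w d ⟩
      w % d                            ∎

  %-injective-< : ∀ {x y} → x < d → y < d → x % d ≡ y % d → x ≡ y
  %-injective-< {x} {y} x<d y<d x≡y = begin
    x       ≡⟨ m<n⇒m%n≡m x<d ⟨
    x % d   ≡⟨ x≡y ⟩
    y % d   ≡⟨ m<n⇒m%n≡m y<d ⟩
    y       ∎

  parity-%-even : parity d ≡ 0ℙ → ∀ x → parity (x % d) ≡ parity x
  parity-%-even d-even x = sym (begin
    parity x                                         ≡⟨ cong parity (m≡m%n+[m/n]*n x d) ⟩
    parity (x % d + x / d * d)                       ≡⟨ +-homo-+ (x % d) (x / d * d) ⟩
    parity (x % d) ℙ.+ parity (x / d * d)            ≡⟨ cong (parity (x % d) ℙ.+_) (*-homo-* (x / d) d) ⟩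
    parity (x % d) ℙ.+ (parity (x / d) ℙ.* parity d) ≡⟨ cong (λ p → parity (x % d) ℙ.+ (parity (x / d) ℙ.* p)) d-even ⟩
    parity (x % d) ℙ.+ (parity (x / d) ℙ.* 0ℙ)       ≡⟨ cong (parity (x % d) ℙ.+_) (ℙₚ.*-zeroʳ (parity (x / d))) ⟩
    parity (x % d) ℙ.+ 0ℙ                            ≡⟨ ℙₚ.+-identityʳ (parity (x % d)) ⟩
    parity (x % d)                                   ∎)

<⇒+≢ : ∀ {m n} o → m < n → n + o ≢ m
<⇒+≢ {m} {n} o m<n n+o≡m = <-irrefl refl (≤-trans m<n (≤-trans (m≤m+n n o) (≤-reflexive n+o≡m)))

parity-1+2* : ∀ m → parity (1 + 2 * m) ≡ 1ℙ
parity-1+2* m = trans (+-homo-+ 1 (2 * m)) (cong (1ℙ ℙ.+_) (*-homo-* 2 m))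

data EvenOrOdd : ℕ → Set where
  even : ∀ i → EvenOrOdd (i * 2)
  odd  : ∀ i → EvenOrOdd (1 + i * 2)

evenOrOdd : ∀ n → EvenOrOdd n
evenOrOdd zero = even 0
evenOrOdd (suc n) with evenOrOdd n
... | even i = odd i
... | odd i  = even (suc i)

cyclicSquare : (n : ℕ) .{{_ : NonZero n}} → (ℕ → ℕ) → Fin n → Fin n → Fin n
cyclicSquare n c r j = fromℕ< (m%n<n (c (toℕ r) + toℕ j) n)

module _ {n : ℕ} .{{_ : NonZero n}} (c : ℕ → ℕ) where

  toℕ-cyclicSquare : ∀ r j → toℕ (cyclicSquare n c r j) ≡ (c (toℕ r) + toℕ j) % n
  toℕ-cyclicSquare r j = toℕ-fromℕ< (m%n<n (c (toℕ r) + toℕ j) n)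

  cyclicSquare-rowInjective : ∀ r → Injective _≡_ _≡_ (cyclicSquare n c r)
  cyclicSquare-rowInjective r {a} {b} eq = toℕ-injective (%-injective-< (toℕ<n a) (toℕ<n b)
    (%-+-cancelˡ (c (toℕ r)) (begin
      (c (toℕ r) + toℕ a) % n    ≡⟨ toℕ-cyclicSquare r a ⟨
      toℕ (cyclicSquare n c r a) ≡⟨ cong toℕ eq ⟩
      toℕ (cyclicSquare n c r b) ≡⟨ toℕ-cyclicSquare r b ⟩
      (c (toℕ r) + toℕ b) % n    ∎)))

  cyclicSquare-columnInjective : (∀ {r r′} → r < n → r′ < n → c r % n ≡ c r′ % n → r ≡ r′) →
                                 ∀ j → Injective _≡_ _≡_ (λ r → cyclicSquare n c r j)
  cyclicSquare-columnInjective c-inj j {a} {b} eq = toℕ-injective (c-inj (toℕ<n a) (toℕ<n b)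
    (%-+-cancelˡ (toℕ j) (begin
      (toℕ j + c (toℕ a)) % n    ≡⟨ cong (_% n) (+-comm (toℕ j) (c (toℕ a))) ⟩
      (c (toℕ a) + toℕ j) % n    ≡⟨ toℕ-cyclicSquare a j ⟨
      toℕ (cyclicSquare n c a j) ≡⟨ cong toℕ eq ⟩
      toℕ (cyclicSquare n c b j) ≡⟨ toℕ-cyclicSquare b j ⟩
      (c (toℕ b) + toℕ j) % n    ≡⟨ cong (_% n) (+-comm (c (toℕ b)) (toℕ j)) ⟩
      (toℕ j + c (toℕ b)) % n    ∎)))

  cyclicSquare-isLatinSquare : (∀ {r r′} → r < n → r′ < n → c r % n ≡ c r′ % n → r ≡ r′) →
                               IsLatinSquare n (cyclicSquare n c)
  cyclicSquare-isLatinSquare c-inj =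
    (λ r → injective⇒exactlyOnce _ (cyclicSquare-rowInjective r)) ,
    (λ j → injective⇒exactlyOnce _ (cyclicSquare-columnInjective c-inj j))

lastLow : ℕ → ℕ
lastLow k = 24 * k + 10

mirror : ℕ → ℕ → ℕ
mirror k r = ord k ∸ 1 ∸ r

c2-low-even : ∀ k i → c2-low k (i * 2) ≡ 30 * k + 13 + i * (12 * k + 6)
c2-low-even k i rewrite m*n%n≡0 i 2 ⦃ _ ⦄ | m*n/n≡m i 2 ⦃ _ ⦄ = refl

c2-low-odd : ∀ k i → c2-low k (1 + i * 2) ≡ 12 * k + 5 + i * (12 * k + 6)
c2-low-odd k i
  rewrite [m+kn]%n≡m%n 1 i 2 ⦃ _ ⦄ | +-distrib-/-∣ʳ 1 {d = 2} (divides-refl i) | m*n/n≡m i 2 ⦃ _ ⦄ = refl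

lastLow+lastLow<ord : ∀ k → lastLow k + lastLow k < ord k
lastLow+lastLow<ord k = ≤-trans (n≤1+n _) (≤-reflexive (sym (ord≡ k)))
  where
  ord≡ : ∀ k → 22 + 48 * k ≡ 2 + ((24 * k + 10) + (24 * k + 10))
  ord≡ = solve-∀

quadruple-c2-low-even : ∀ k i → i * 2 ≤ lastLow k → (4 * c2-low k (i * 2) + 2) % ord k ≡ lastLow k + i * 2
quadruple-c2-low-even k i 2i≤ = begin
  (4 * c2-low k (i * 2) + 2) % ord k                  ≡⟨ cong (λ t → (4 * t + 2) % ord k) (c2-low-even k i) ⟩
  (4 * (30 * k + 13 + i * (12 * k + 6)) + 2) % ord k  ≡⟨ cong (_% ord k) (unfold k i) ⟩
  (lastLow k + i * 2 + (2 + i) * ord k) % ord k       ≡⟨ [m+kn]%n≡m%n (lastLow k + i * 2) (2 + i) (ord k) ⟩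
  (lastLow k + i * 2) % ord k                         ≡⟨ m<n⇒m%n≡m (≤-<-trans (+-monoʳ-≤ (lastLow k) 2i≤) (lastLow+lastLow<ord k)) ⟩
  lastLow k + i * 2                                   ∎
  where
  unfold : ∀ k i → 4 * (30 * k + 13 + i * (12 * k + 6)) + 2 ≡ 24 * k + 10 + i * 2 + (2 + i) * (22 + 48 * k)
  unfold = solve-∀

quadruple-c2-low-odd : ∀ k i → 1 + i * 2 ≤ lastLow k → (4 * c2-low k (1 + i * 2) + 2) % ord k ≡ i * 2
quadruple-c2-low-odd k i 2i+1≤ = begin
  (4 * c2-low k (1 + i * 2) + 2) % ord k             ≡⟨ cong (λ t → (4 * t + 2) % ord k) (c2-low-odd k i) ⟩
  (4 * (12 * k + 5 + i * (12 * k + 6)) + 2) % ord k  ≡⟨ cong (_% ord k) (unfold k i) ⟩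
  (i * 2 + (1 + i) * ord k) % ord k                  ≡⟨ [m+kn]%n≡m%n (i * 2) (1 + i) (ord k) ⟩
  (i * 2) % ord k                                    ≡⟨ m<n⇒m%n≡m (≤-trans 2i+1≤ (≤-trans (m≤m+n _ _) (<⇒≤ (lastLow+lastLow<ord k)))) ⟩
  i * 2                                              ∎
  where
  unfold : ∀ k i → 4 * (12 * k + 5 + i * (12 * k + 6)) + 2 ≡ i * 2 + (1 + i) * (22 + 48 * k)
  unfold = solve-∀

quadruple-%-cong : ∀ k {x y} → x % ord k ≡ y % ord k → (4 * x + 2) % ord k ≡ (4 * y + 2) % ord k
quadruple-%-cong k {x} {y} eq = %-+-congʳ 2 {4 * x} {4 * y} (%-*-congˡ 4 {x} {y} eq)

quadrupled-c2-low-injective : ∀ k {r r′} → EvenOrOdd r → EvenOrOdd r′ → r ≤ lastLow k → r′ ≤ lastLow k →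
                              (4 * c2-low k r + 2) % ord k ≡ (4 * c2-low k r′ + 2) % ord k → r ≡ r′
quadrupled-c2-low-injective k (even i) (even i′) r≤ r′≤ q =
  +-cancelˡ-≡ (lastLow k) _ _ (trans (sym (quadruple-c2-low-even k i r≤)) (trans q (quadruple-c2-low-even k i′ r′≤)))
quadrupled-c2-low-injective k (odd i) (odd i′) r≤ r′≤ q =
  cong suc (trans (sym (quadruple-c2-low-odd k i r≤)) (trans q (quadruple-c2-low-odd k i′ r′≤)))
quadrupled-c2-low-injective k (even i) (odd i′) r≤ r′≤ q = contradiction
  (trans (sym (quadruple-c2-low-even k i r≤)) (trans q (quadruple-c2-low-odd k i′ r′≤))) (<⇒+≢ (i * 2) r′≤)
quadrupled-c2-low-injective k (odd i) (even i′) r≤ r′≤ q = contradiction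
  (trans (sym (quadruple-c2-low-even k i′ r′≤)) (trans (sym q) (quadruple-c2-low-odd k i r≤))) (<⇒+≢ (i′ * 2) r≤)

c2-low-injective : ∀ k {r r′} → r ≤ lastLow k → r′ ≤ lastLow k →
                   c2-low k r % ord k ≡ c2-low k r′ % ord k → r ≡ r′
c2-low-injective k {r} {r′} r≤ r′≤ eq = quadrupled-c2-low-injective k (evenOrOdd r) (evenOrOdd r′) r≤ r′≤
  (quadruple-%-cong k {c2-low k r} {c2-low k r′} eq)

parity-c2-low : ∀ k r → parity (c2-low k r) ≡ 1ℙ
parity-c2-low k r with evenOrOdd r
... | even i = trans (cong parity (trans (c2-low-even k i) (odd-form k i))) (parity-1+2* (15 * k + 6 + i * (6 * k + 3)))
  where
  odd-form : ∀ k i → 30 * k + 13 + i * (12 * k + 6) ≡ 1 + 2 * (15 * k + 6 + i * (6 * k + 3))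
  odd-form = solve-∀
... | odd i = trans (cong parity (trans (c2-low-odd k i) (odd-form k i))) (parity-1+2* (6 * k + 2 + i * (6 * k + 3)))
  where
  odd-form : ∀ k i → 12 * k + 5 + i * (12 * k + 6) ≡ 1 + 2 * (6 * k + 2 + i * (6 * k + 3))
  odd-form = solve-∀

parity-ord : ∀ k → parity (ord k) ≡ 0ℙ
parity-ord k = trans (cong parity (even-form k)) (*-homo-* 2 (11 + 24 * k))
  where
  even-form : ∀ k → 22 + 48 * k ≡ 2 * (11 + 24 * k)
  even-form = solve-∀

parity-c2-low%ord : ∀ k r → parity (c2-low k r % ord k) ≡ 1ℙ
parity-c2-low%ord k r = trans (parity-%-even (parity-ord k) (c2-low k r)) (parity-c2-low k r)

c2-cases : ∀ k r → (r ≤ lastLow k × c2 k r ≡ c2-low k r % ord k)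
                 ⊎ (lastLow k < r × c2 k r + c2-low k (mirror k r) % ord k ≡ ord k ∸ 1)
c2-cases k r with r ≤? 24 * k + 10
... | yes r≤ = inj₁ (r≤ , refl)
... | no  r≰ = inj₂ (≰⇒> r≰ , m∸n+n≡m (≤-pred (m%n<n (c2-low k (mirror k r)) (ord k))))

c2<ord : ∀ k r → c2 k r < ord k
c2<ord k r with c2-cases k r
... | inj₁ (_ , c≡) = subst (_< ord k) (sym c≡) (m%n<n (c2-low k r) (ord k))
... | inj₂ (_ , c+v≡) = ≤-<-trans (m≤m+n (c2 k r) _) (subst (_< ord k) (sym c+v≡) (n<1+n _))

parity-mirrored : ∀ k x r → x + c2-low k r % ord k ≡ ord k ∸ 1 → parity x ≡ 0ℙ
parity-mirrored k x r x+v≡ = ℙₚ.+-cancelʳ-≡ 1ℙ (parity x) 0ℙ (begin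
  parity x ℙ.+ 1ℙ                            ≡⟨ cong (parity x ℙ.+_) (parity-c2-low%ord k r) ⟨
  parity x ℙ.+ parity (c2-low k r % ord k)  ≡⟨ +-homo-+ x (c2-low k r % ord k) ⟨
  parity (x + c2-low k r % ord k)           ≡⟨ cong parity x+v≡ ⟩
  parity (21 + 48 * k)                      ≡⟨ cong parity (odd-form k) ⟩
  parity (1 + 2 * (10 + 24 * k))            ≡⟨ parity-1+2* (10 + 24 * k) ⟩
  1ℙ                                        ∎)
  where
  odd-form : ∀ k → 21 + 48 * k ≡ 1 + 2 * (10 + 24 * k)
  odd-form = solve-∀

mirror≤lastLow : ∀ k {r} → lastLow k < r → mirror k r ≤ lastLow k
mirror≤lastLow k r> = ≤-trans (∸-monoʳ-≤ (ord k ∸ 1) r>) (≤-reflexive (begin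
  (21 + 48 * k) ∸ suc (lastLow k)                  ≡⟨ cong (_∸ suc (lastLow k)) (split k) ⟩
  (lastLow k + suc (lastLow k)) ∸ suc (lastLow k)  ≡⟨ m+n∸n≡m (lastLow k) (suc (lastLow k)) ⟩
  lastLow k                                        ∎))
  where
  split : ∀ k → 21 + 48 * k ≡ (24 * k + 10) + suc (24 * k + 10)
  split = solve-∀

low≢mirrored : ∀ k r x s → x + c2-low k s % ord k ≡ ord k ∸ 1 → c2-low k r % ord k ≢ x
low≢mirrored k r x s x+v≡ eq = contradiction
  (trans (sym (parity-c2-low%ord k r)) (trans (cong parity eq) (parity-mirrored k x s x+v≡))) λ ()

c2-injective : ∀ k {r r′} → r < ord k → r′ < ord k → c2 k r ≡ c2 k r′ → r ≡ r′
c2-injective k {r} {r′} r< r′< eq with c2-cases k r | c2-cases k r′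
... | inj₁ (r≤ , c≡) | inj₁ (r′≤ , c′≡) = c2-low-injective k r≤ r′≤ (trans (sym c≡) (trans eq c′≡))
... | inj₂ (r> , c+v≡) | inj₂ (r′> , c′+v′≡) =
  ∸-cancelˡ-≡ (≤-pred r<) (≤-pred r′<) (c2-low-injective k (mirror≤lastLow k r>) (mirror≤lastLow k r′>)
    (+-cancelˡ-≡ (c2 k r) _ _ (trans c+v≡ (trans (sym c′+v′≡) (cong (_+ _) (sym eq))))))
... | inj₁ (_ , c≡) | inj₂ (_ , c′+v′≡) =
  ⊥-elim (low≢mirrored k r (c2 k r′) (mirror k r′) c′+v′≡ (trans (sym c≡) eq))
... | inj₂ (_ , c+v≡) | inj₁ (_ , c′≡) =
  ⊥-elim (low≢mirrored k r′ (c2 k r) (mirror k r) c+v≡ (trans (sym c′≡) (sym eq)))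

lemma5 : (k : ℕ) → IsLatinSquare (ord k) (L2 k)
lemma5 k = cyclicSquare-isLatinSquare (c2 k) λ {r} {r′} r< r′< c≡c′ →
  c2-injective k r< r′< (%-injective-< (c2<ord k r) (c2<ord k r′) c≡c′)
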